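{- Let $\mathcal{C}$ be an asymmetric combination of logics. The lifting of comorphisms by $\mathcal{C}$ preserves identities and distributes over composition: for every institution $\mathcal{I}$, $\mathcal{C}(1_{Sign^{\mathcal{I}}},1_{Sen^{\mathcal{I}}},1_{Mod^{\mathcal{I}}})=(1_{Sign^{\mathcal{C}\mathcal{I}}},1_{Sen^{\mathcal{C}\mathcal{I}}},1_{Mod^{\mathcal{C}\mathcal{I}}})$; and for comorphisms $(\Phi_1,\alpha_1,\beta_1):\mathcal{I}\to\mathcal{I}'$ and $(\Phi_2,\alpha_2,\beta_2):\mathcal{I}'\to\mathcal{I}''$, $\mathcal{C}\big((\Phi_2,\alpha_2,\beta_2);(\Phi_1,\alpha_1,\beta_1)\big)=\mathcal{C}(\Phi_2,\alpha_2,\beta_2);\mathcal{C}(\Phi_1,\alpha_1,\beta_1)$, i.e. $\mathcal{C}(\Phi_2\circ\Phi_1)=\mathcal{C}\Phi_2\circ\mathcal{C}\Phi_1$, $\mathcal{C}((\alpha_2\circ 1_{\Phi_1})\cdot\alpha_1)=(\mathcal{C}\alpha_2\circ1_{\mathcal{C}\Phi_1})\cdot\mathcal{C}\alpha_1$ and $\mathcal{C}(\beta_1\cdot(\beta_2\circ1_{\Phi_1^{op}}))=\mathcal{C}\beta_1\cdot(\mathcal{C}\beta_2\circ1_{\mathcal{C}\Phi_1^{op}})$.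
   Context: An institution $\mathcal{I}$ consists of a signature category $Sign^{\mathcal{I}}$, a sentence functor $Sen^{\mathcal{I}}:Sign^{\mathcal{I}}\to\mathbf{Set}$, a model functor $Mod^{\mathcal{I}}:(Sign^{\mathcal{I}})^{op}\to\mathbf{Cat}$ and satisfaction relations $\models_\Sigma\subseteq|Mod^{\mathcal{I}}(\Sigma)|\times Sen^{\mathcal{I}}(\Sigma)$ obeying the satisfaction condition. A comorphism $(\Phi,\alpha,\beta):\mathcal{I}\to\mathcal{I}'$ consists of a functor $\Phi:Sign^{\mathcal{I}}\to Sign^{\mathcal{I}'}$, natural transformations $\alpha:Sen^{\mathcal{I}}\Rightarrow Sen^{\mathcal{I}'}\circ\Phi$ and $\beta:Mod^{\mathcal{I}'}\circ\Phi^{op}\Rightarrow Mod^{\mathcal{I}}$ with $\beta_\Sigma(M)\models\rho$ iff $M\models\alpha_\Sigma(\rho)$. The composite of $(\Phi_1,\alpha_1,\beta_1):\mathcal{I}\to\mathcal{I}'$ and $(\Phi_2,\alpha_2,\beta_2):\mathcal{I}'\to\mathcal{I}''$ is $(\Phi_2,\alpha_2,\beta_2);(\Phi_1,\alpha_1,\beta_1)=(\Phi_2\circ\Phi_1,(\alpha_2\circ1_{\Phi_1})\cdot\alpha_1,\beta_1\cdot(\beta_2\circ1_{\Phi_1^{op}}))$, where $\circ$ between natural transformations is horizontal (Godement) composition and $\cdot$ is vertical composition; componentwise, the sentence part at $\Sigma$ is $(\alpha_2)_{\Phi_1(\Sigma)}\circ(\alpha_1)_\Sigma$ and the model part is $(\beta_1)_\Sigma\circ(\beta_2)_{\Phi_1(\Sigma)}$.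 The identity comorphism is $(1_{Sign^{\mathcal{I}}},1_{Sen^{\mathcal{I}}},1_{Mod^{\mathcal{I}}})$. An asymmetric combination $\mathcal{C}$ consists of a category $Sign^{\mathcal{C}}$, a functor $M^{\mathcal{C}}:(Sign^{\mathcal{C}})^{op}\to\mathbf{Cat}$ with, for each $\Delta$, a functor $U:M^{\mathcal{C}}(\Delta)\to\mathbf{Set}$ commuting with the reduct functors $M^{\mathcal{C}}(\varphi)$, a sentence construction, and a lifting of satisfaction. Applied to an institution $\mathcal{I}$ it gives $\mathcal{C}\mathcal{I}$ with $Sign^{\mathcal{C}\mathcal{I}}=Sign^{\mathcal{C}}\times Sign^{\mathcal{I}}$; $Sen^{\mathcal{C}\mathcal{I}}(\Delta,\Sigma)$ an inductively defined (grammar-generated) set of sentences whose atoms include the base sentences $\psi\in Sen^{\mathcal{I}}(\Sigma)$; and $Mod^{\mathcal{C}\mathcal{I}}(\Delta,\Sigma)$ the discrete category of triples $(S,R,m)$ with $R\in|M^{\mathcal{C}}(\Delta)|$, $U(R)=S$, $m:S\to|Mod^{\mathcal{I}}(\Sigma)|$. The lifting of a comorphism $(\Phi,\alpha,\beta):\mathcal{I}\to\mathcal{I}'$ is the triple $(\mathcal{C}\Phi,\mathcal{C}\alpha,\mathcal{C}\beta)$ with $\mathcal{C}\Phi=1_{Sign^{\mathcal{C}}}\times\Phi$, $(\mathcal{C}\alpha)_{(\Delta,\Sigma)}(\rho)=\rho$ with each base sentence $\psi\in Sen^{\mathcal{I}}(\Sigma)$ replaced by $\alpha_\Sigma(\psi)$,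 and $(\mathcal{C}\beta)_{(\Delta,\Sigma)}(S,R,m)=(S,R,\beta_\Sigma\circ m)$. Composition and identities of lifted triples are defined by the same formulas as for comorphisms. -}

module Defs where

open import Level using (Level; _⊔_; Setω) renaming (suc to lsuc)
open import Data.Product using (_×_; _,_; proj₁; proj₂)
open import Function using (_⇔_)
open import Relation.Binary.PropositionalEquality
  using (_≡_; refl; sym; subst; subst₂)

record Category (o h : Level) : Set (lsuc (o ⊔ h)) where
  infixr 9 _∘_
  field
    Obj   : Set o
    Hom   : Obj → Obj → Set h
    id    : ∀ {A} → Hom A A
    _∘_   : ∀ {A B C} → Hom B C → Hom A B → Hom A C
    idˡ   : ∀ {A B} (f : Hom A B) → id ∘ f ≡ f
    idʳ   : ∀ {A B} (f : Hom A B) → f ∘ id ≡ f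
    assoc : ∀ {A B C D} (h : Hom C D) (g : Hom B C) (f : Hom A B) →
            (h ∘ g) ∘ f ≡ h ∘ (g ∘ f)

open Category public using (Obj; Hom)

_ᵒᵖ : ∀ {o h} → Category o h → Category o h
C ᵒᵖ = record
  { Obj = Obj C ; Hom = λ A B → Hom C B A ; id = Category.id C
  ; _∘_ = λ g f → Category._∘_ C f g
  ; idˡ = Category.idʳ C ; idʳ = Category.idˡ C
  ; assoc = λ h g f → sym (Category.assoc C f g h) }

_⊗_ : ∀ {o h o' h'} → Category o h → Category o' h' → Category (o ⊔ o') (h ⊔ h')
C ⊗ D = record
  { Obj = Obj C × Obj D
  ; Hom = λ A B → Hom C (proj₁ A) (proj₁ B) × Hom D (proj₂ A) (proj₂ B)
  ; id = Category.id C , Category.id D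
  ; _∘_ = λ g f → Category._∘_ C (proj₁ g) (proj₁ f) , Category._∘_ D (proj₂ g) (proj₂ f)
  ; idˡ = λ f → pair≡ (Category.idˡ C (proj₁ f)) (Category.idˡ D (proj₂ f))
  ; idʳ = λ f → pair≡ (Category.idʳ C (proj₁ f)) (Category.idʳ D (proj₂ f))
  ; assoc = λ h g f → pair≡ (Category.assoc C (proj₁ h) (proj₁ g) (proj₁ f))
                            (Category.assoc D (proj₂ h) (proj₂ g) (proj₂ f)) }
  where
  pair≡ : ∀ {a b} {A : Set a} {B : Set b} {x x' : A} {y y' : B} →
          x ≡ x' → y ≡ y' → (x , y) ≡ (x' , y')
  pair≡ refl refl = refl

record Functor {o h o' h'} (C : Category o h) (D : Category o' h')
       : Set (o ⊔ h ⊔ o' ⊔ h') where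
  field
    F₀    : Obj C → Obj D
    F₁    : ∀ {A B} → Hom C A B → Hom D (F₀ A) (F₀ B)
    F-id  : ∀ {A} → F₁ (Category.id C {A}) ≡ Category.id D
    F-∘   : ∀ {A B E} (g : Hom C B E) (f : Hom C A B) →
            F₁ (Category._∘_ C g f) ≡ Category._∘_ D (F₁ g) (F₁ f)

open Functor public using (F₀; F₁)

idF : ∀ {o h} {C : Category o h} → Functor C C
idF = record { F₀ = λ X → X ; F₁ = λ f → f ; F-id = refl ; F-∘ = λ _ _ → refl }

trans' : ∀ {a} {A : Set a} {x y z : A} → x ≡ y → y ≡ z → x ≡ z
trans' refl q = q

cong' : ∀ {a b} {A : Set a} {B : Set b} (f : A → B) {x y : A} → x ≡ y → f x ≡ f y
cong' f refl = refl

_∘F_ : ∀ {o₁ h₁ o₂ h₂ o₃ h₃} {C : Category o₁ h₁} {D : Category o₂ h₂}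
         {E : Category o₃ h₃} → Functor D E → Functor C D → Functor C E
G ∘F F = record
  { F₀ = λ X → F₀ G (F₀ F X)
  ; F₁ = λ f → F₁ G (F₁ F f)
  ; F-id = trans' (cong' (F₁ G) (Functor.F-id F)) (Functor.F-id G)
  ; F-∘ = λ g f → trans' (cong' (F₁ G) (Functor.F-∘ F g f))
                         (Functor.F-∘ G (F₁ F g) (F₁ F f)) }

_×F_ : ∀ {o₁ h₁ o₂ h₂ o₃ h₃ o₄ h₄} {C : Category o₁ h₁} {C' : Category o₂ h₂}
         {D : Category o₃ h₃} {D' : Category o₄ h₄} →
       Functor C C' → Functor D D' → Functor (C ⊗ D) (C' ⊗ D')
F ×F G = record
  { F₀ = λ X → F₀ F (proj₁ X) , F₀ G (proj₂ X)
  ; F₁ = λ f → F₁ F (proj₁ f) , F₁ G (proj₂ f)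
  ; F-id = pair≡ (Functor.F-id F) (Functor.F-id G)
  ; F-∘ = λ g f → pair≡ (Functor.F-∘ F (proj₁ g) (proj₁ f))
                        (Functor.F-∘ G (proj₂ g) (proj₂ f)) }
  where
  pair≡ : ∀ {a b} {A : Set a} {B : Set b} {x x' : A} {y y' : B} →
          x ≡ x' → y ≡ y' → (x , y) ≡ (x' , y')
  pair≡ refl refl = refl

record _≡F_ {o h o' h'} {C : Category o h} {D : Category o' h'}
            (F G : Functor C D) : Set (o ⊔ h ⊔ o' ⊔ h') where
  field
    eq₀ : ∀ X → F₀ F X ≡ F₀ G X
    eq₁ : ∀ {X Y} (f : Hom C X Y) →
          subst₂ (Hom D) (eq₀ X) (eq₀ Y) (F₁ F f) ≡ F₁ G f

record SetFunctor {o h} (C : Category o h) (ℓ : Level) : Set (o ⊔ h ⊔ lsuc ℓ) where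
  field
    S₀   : Obj C → Set ℓ
    S₁   : ∀ {A B} → Hom C A B → S₀ A → S₀ B
    S-id : ∀ {A} (x : S₀ A) → S₁ (Category.id C) x ≡ x
    S-∘  : ∀ {A B E} (g : Hom C B E) (f : Hom C A B) (x : S₀ A) →
           S₁ (Category._∘_ C g f) x ≡ S₁ g (S₁ f x)

open SetFunctor public using (S₀; S₁)

record CatFunctorOp {o h} (C : Category o h) (mo mh : Level)
       : Set (o ⊔ h ⊔ lsuc (mo ⊔ mh)) where
  field
    Cat₀   : Obj C → Category mo mh
    red    : ∀ {A B} → Hom C A B → Functor (Cat₀ B) (Cat₀ A)
    red-id : ∀ {A} → red (Category.id C {A}) ≡F idF
    red-∘  : ∀ {A B E} (g : Hom C B E) (f : Hom C A B) →
             red (Category._∘_ C g f) ≡F (red f ∘F red g)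

open CatFunctorOp public using (Cat₀; red)

record ILv : Set where
  constructor ilv
  field
    so sh sn mo mh r : Level

ILevel : ILv → Level
ILevel (ilv so sh sn mo mh r) = lsuc (so ⊔ sh ⊔ sn ⊔ mo ⊔ mh ⊔ r)

record Institution (L : ILv) : Set (ILevel L) where
  open ILv L
  field
    Sign : Category so sh
    Sen  : SetFunctor Sign sn
    Mod  : CatFunctorOp Sign mo mh
    _⊨_ : ∀ {Σ} → Obj (Cat₀ Mod Σ) → S₀ Sen Σ → Set r
    sat-cond : ∀ {Σ Σ'} (σ : Hom Sign Σ Σ') (M' : Obj (Cat₀ Mod Σ'))
               (ρ : S₀ Sen Σ) →
               (F₀ (red Mod σ) M' ⊨ ρ) ⇔ (M' ⊨ S₁ Sen σ ρ)

open Institution public using (Sign; Sen; Mod)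

record RawComorphism {L L'} (I : Institution L) (I' : Institution L')
       : Set (ILevel L ⊔ ILevel L') where
  constructor raw
  field
    Φ : Functor (Sign I) (Sign I')
    α : ∀ Σ → S₀ (Sen I) Σ → S₀ (Sen I') (F₀ Φ Σ)
    β : ∀ Σ → Functor (Cat₀ (Mod I') (F₀ Φ Σ)) (Cat₀ (Mod I) Σ)

record Comorphism {L L'} (I : Institution L) (I' : Institution L')
       : Set (ILevel L ⊔ ILevel L') where
  field
    rawC : RawComorphism I I'
  open RawComorphism rawC
  field
    α-nat : ∀ {Σ₁ Σ₂} (σ : Hom (Sign I) Σ₁ Σ₂) (ρ : S₀ (Sen I) Σ₁) →
            α Σ₂ (S₁ (Sen I) σ ρ) ≡ S₁ (Sen I') (F₁ Φ σ) (α Σ₁ ρ)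
    β-nat : ∀ {Σ₁ Σ₂} (σ : Hom (Sign I) Σ₁ Σ₂) →
            (β Σ₁ ∘F red (Mod I') (F₁ Φ σ)) ≡F (red (Mod I) σ ∘F β Σ₂)
    sat   : ∀ Σ (M : Obj (Cat₀ (Mod I') (F₀ Φ Σ))) (ρ : S₀ (Sen I) Σ) →
            Institution._⊨_ I (F₀ (β Σ) M) ρ ⇔ Institution._⊨_ I' M (α Σ ρ)

open Comorphism public using (rawC)

idRaw : ∀ {L} (I : Institution L) → RawComorphism I I
idRaw I = raw idF (λ Σ ρ → ρ) (λ Σ → idF)

-- (Φ₂,α₂,β₂) ; (Φ₁,α₁,β₁) = (Φ₂∘Φ₁ , (α₂∘1_Φ₁)·α₁ , β₁·(β₂∘1_Φ₁^op))
_⊙R_ : ∀ {L L' L''} {I : Institution L} {I' : Institution L'}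
         {I'' : Institution L''} →
       RawComorphism I' I'' → RawComorphism I I' → RawComorphism I I''
raw Φ₂ α₂ β₂ ⊙R raw Φ₁ α₁ β₁ =
  raw (Φ₂ ∘F Φ₁)
      (λ Σ ρ → α₂ (F₀ Φ₁ Σ) (α₁ Σ ρ))
      (λ Σ → β₁ Σ ∘F β₂ (F₀ Φ₁ Σ))

record CLv : Set where
  constructor clv
  field
    co ch mo mh u g : Level

CLevel : CLv → Level
CLevel (clv co ch mo mh u g) = lsuc (co ⊔ ch ⊔ mo ⊔ mh ⊔ u ⊔ g)

-- A sentence grammar over Sign^C: at signature Δ there are atoms
-- (e.g. nominals) and connectives/binders; a connective o at Δ has
-- arguments indexed by Ar o, the i-th living at signature child o i
-- (this covers binders that extend Δ).
record Grammar {co ch} (SC : Category co ch) (g : Level) : Set (co ⊔ lsuc g) where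
  field
    Atom  : Obj SC → Set g
    Op    : Obj SC → Set g
    Ar    : ∀ {Δ} → Op Δ → Set g
    child : ∀ {Δ} (o : Op Δ) → Ar o → Obj SC

record AsymComb (L : CLv) : Set (CLevel L) where
  open CLv L
  field
    SignC : Category co ch
    MC    : CatFunctorOp SignC mo mh
    U     : ∀ Δ → SetFunctor (Cat₀ MC Δ) u
    U-red₀ : ∀ {Δ Δ'} (φ : Hom SignC Δ Δ') (R : Obj (Cat₀ MC Δ')) →
             S₀ (U Δ) (F₀ (red MC φ) R) ≡ S₀ (U Δ') R
    U-red₁ : ∀ {Δ Δ'} (φ : Hom SignC Δ Δ') {R₁ R₂ : Obj (Cat₀ MC Δ')}
             (f : Hom (Cat₀ MC Δ') R₁ R₂) (x : S₀ (U Δ) (F₀ (red MC φ) R₁)) →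
             subst (λ X → X) (U-red₀ φ R₂) (S₁ (U Δ) (F₁ (red MC φ) f) x)
               ≡ S₁ (U Δ') f (subst (λ X → X) (U-red₀ φ R₁) x)
    grammar : Grammar SignC g

module _ {co ch g} {SC : Category co ch} (G : Grammar SC g) where
  open Grammar G

  data Form {b} (B : Set b) : Obj SC → Set (co ⊔ g ⊔ b) where
    base : ∀ {Δ} → B → Form B Δ
    atom : ∀ {Δ} → Atom Δ → Form B Δ
    op   : ∀ {Δ} (o : Op Δ) → ((i : Ar o) → Form B (child o i)) → Form B Δ

  mapForm : ∀ {b b'} {B : Set b} {B' : Set b'} → (B → B') →
            ∀ {Δ} → Form B Δ → Form B' Δ
  mapForm f (base ψ) = base (f ψ)
  mapForm f (atom a) = atom a
  mapForm f (op o k) = op o (λ i → mapForm f (k i))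

  data _≈S_ {b} {B : Set b} : ∀ {Δ} → Form B Δ → Form B Δ → Set (co ⊔ g ⊔ b) where
    base≈ : ∀ {Δ} {ψ ψ' : B} → ψ ≡ ψ' → base {Δ = Δ} ψ ≈S base ψ'
    atom≈ : ∀ {Δ} (a : Atom Δ) → atom a ≈S atom a
    op≈   : ∀ {Δ} (o : Op Δ) {k k' : (i : Ar o) → Form B (child o i)} →
            (∀ i → k i ≈S k' i) → op o k ≈S op o k'

module _ {LC} (C : AsymComb LC) where
  open AsymComb C

  CSign : ∀ {L} → Institution L → Category _ _
  CSign I = SignC ⊗ Sign I

  CSen : ∀ {L} (I : Institution L) → Obj (CSign I) → Set _
  CSen I (Δ , Σ) = Form grammar (S₀ (Sen I) Σ) Δ

  -- a model (S , R , m) with U(R) = S; S is given as U(R)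
  record CModel {L} (I : Institution L) (X : Obj (CSign I)) : Set
         (CLv.mo LC ⊔ CLv.u LC ⊔ ILv.mo L) where
    constructor cmodel
    field
      R : Obj (Cat₀ MC (proj₁ X))
      m : S₀ (U (proj₁ X)) R → Obj (Cat₀ (Mod I) (proj₂ X))

  -- equality of objects of the discrete model category
  record _≈M_ {L} {I : Institution L} {X} (M₁ M₂ : CModel I X) : Set
         (CLv.mo LC ⊔ CLv.u LC ⊔ ILv.mo L) where
    field
      R-eq : CModel.R M₁ ≡ CModel.R M₂
      m-eq : ∀ s → CModel.m M₁ s ≡ CModel.m M₂ (subst (S₀ (U (proj₁ X))) R-eq s)

  record LTriple {L L'} (I : Institution L) (I' : Institution L')
         : Set (CLevel LC ⊔ ILevel L ⊔ ILevel L') where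
    constructor ltriple
    field
      LΦ : Functor (CSign I) (CSign I')
      Lα : ∀ X → CSen I X → CSen I' (F₀ LΦ X)
      Lβ : ∀ X → CModel I' (F₀ LΦ X) → CModel I X

  lift : ∀ {L L'} {I : Institution L} {I' : Institution L'} →
         RawComorphism I I' → LTriple I I'
  lift (raw Φ α β) = ltriple
    (idF ×F Φ)
    (λ X ρ → mapForm grammar (α (proj₂ X)) ρ)
    (λ X M → cmodel (CModel.R M) (λ s → F₀ (β (proj₂ X)) (CModel.m M s)))

  idL : ∀ {L} (I : Institution L) → LTriple I I
  idL I = ltriple idF (λ X ρ → ρ) (λ X M → M)

  _⊙L_ : ∀ {L L' L''} {I : Institution L} {I' : Institution L'}
           {I'' : Institution L''} →
         LTriple I' I'' → LTriple I I' → LTriple I I''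
  ltriple Φ₂ α₂ β₂ ⊙L ltriple Φ₁ α₁ β₁ =
    ltriple (Φ₂ ∘F Φ₁)
            (λ X ρ → α₂ (F₀ Φ₁ X) (α₁ X ρ))
            (λ X M → β₁ X (β₂ (F₀ Φ₁ X) M))

  record _≈L_ {L L'} {I : Institution L} {I' : Institution L'}
              (T₁ T₂ : LTriple I I') : Set (CLevel LC ⊔ ILevel L ⊔ ILevel L') where
    open LTriple
    field
      Φ-eq : LΦ T₁ ≡F LΦ T₂
      α-eq : ∀ X (ρ : CSen I X) →
             _≈S_ grammar (subst (CSen I') (_≡F_.eq₀ Φ-eq X) (Lα T₁ X ρ)) (Lα T₂ X ρ)
      β-eq : ∀ X (M : CModel I' (F₀ (LΦ T₂) X)) →
             Lβ T₁ X (subst (CModel I') (sym (_≡F_.eq₀ Φ-eq X)) M) ≈M Lβ T₂ X M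

record _∧ω_ (A B : Setω) : Setω where
  constructor _,ω_
  field
    fstω : A
    sndω : B

-- Lifting acts on a comorphism componentwise: the signature functor becomes
-- 1 × Φ, the model part acts pointwise on the labelling m, and the sentence
-- part is the action of the grammar on base sentences. Hence both laws hold
-- definitionally except on sentences, where they are the functor laws of
-- mapForm, proved by induction.
module Submission where

open import Defs
open import Relation.Binary.PropositionalEquality using (refl)

module _ {co ch g} {SC : Category co ch} (G : Grammar SC g) where

  mapForm-id : ∀ {b} {B : Set b} {Δ} (ρ : Form G B Δ) →
               _≈S_ G (mapForm G (λ x → x) ρ) ρ
  mapForm-id (base ψ) = base≈ refl
  mapForm-id (atom a) = atom≈ a
  mapForm-id (op o k) = op≈ o (λ i → mapForm-id (k i))

  mapForm-∘ : ∀ {b b' b''} {B : Set b} {B' : Set b'} {B'' : Set b''}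
              (f : B → B') (h : B' → B'') {Δ} (ρ : Form G B Δ) →
              _≈S_ G (mapForm G (λ x → h (f x)) ρ) (mapForm G h (mapForm G f ρ))
  mapForm-∘ f h (base ψ) = base≈ refl
  mapForm-∘ f h (atom a) = atom≈ a
  mapForm-∘ f h (op o k) = op≈ o (λ i → mapForm-∘ f h (k i))

module _ {LC} (C : AsymComb LC) where
  open AsymComb C using (grammar)

  lift-id : ∀ {L} (I : Institution L) → _≈L_ C (lift C (idRaw I)) (idL C I)
  lift-id I = record
    { Φ-eq = record { eq₀ = λ X → refl ; eq₁ = λ f → refl }
    ; α-eq = λ X ρ → mapForm-id grammar ρ
    ; β-eq = λ X M → record { R-eq = refl ; m-eq = λ s → refl }
    }

  lift-⊙ : ∀ {L L' L''} {I : Institution L} {I' : Institution L'}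
             {I'' : Institution L''}
           (r₂ : RawComorphism I' I'') (r₁ : RawComorphism I I') →
           _≈L_ C (lift C (r₂ ⊙R r₁)) (_⊙L_ C (lift C r₂) (lift C r₁))
  lift-⊙ (raw Φ₂ α₂ β₂) (raw Φ₁ α₁ β₁) = record
    { Φ-eq = record { eq₀ = λ X → refl ; eq₁ = λ f → refl }
    ; α-eq = λ X ρ → mapForm-∘ grammar (α₁ _) (α₂ _) ρ
    ; β-eq = λ X M → record { R-eq = refl ; m-eq = λ s → refl }
    }

lemma1 : ∀ {LC} (C : AsymComb LC) →
    (∀ {L} (I : Institution L) → _≈L_ C (lift C (idRaw I)) (idL C I))
    ∧ω (∀ {L L' L''} {I : Institution L} {I' : Institution L'} {I'' : Institution L''}
    (c₁ : Comorphism I I') (c₂ : Comorphism I' I'') →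
    _≈L_ C (lift C (rawC c₂ ⊙R rawC c₁)) (_⊙L_ C (lift C (rawC c₂)) (lift C (rawC c₁))))
lemma1 C = lift-id C ,ω (λ c₁ c₂ → lift-⊙ C (rawC c₂) (rawC c₁))
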